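{- Suppose that $1\leq n<\omega$, $H$ is a set of ordinals with no largest element, and $\langle u_b\mid b\in[H]^n\rangle$ is a uniform $n$-dimensional $\Delta$-system, witnessed by an ordinal $\rho$ and sets $\langle\mathbf{r}_{\mathbf{m}}\mid\mathbf{m}\subseteq n\rangle$. For each $m<n$ and each $a\in[H]^m$, define $u_a$ by choosing $b\in[H]^n$ with $b[m]=a$ (i.e. $b$ end-extends $a$) and setting $u_a=u_b[\mathbf{r}_m]$, where $\mathbf{r}_m=\mathbf{r}_{\{\ell\mid\ell<m\}}$. Then: (1) this definition of $u_a$ is independent of the choice of $b$; (2) for each $a\in[H]^{<n}$, the collection $\{u_{a\cup\{\beta\}}\mid\beta\in H\setminus(\max(a)+1)\}$ is a ($1$-dimensional) $\Delta$-system with root $u_a$ (for $a=\emptyset$, $\beta$ ranges over all of $H$).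
   Context: Finite sets of ordinals are identified with their increasing enumerations: for a set of ordinals $a$ and $\ell<\mathrm{otp}(a)$, $a(\ell)$ is the unique $\alpha\in a$ with $|a\cap\alpha|=\ell$, and for $\mathbf{m}\subseteq\mathrm{otp}(a)$, $a[\mathbf{m}]=\{a(\ell)\mid\ell\in\mathbf{m}\}$. A natural number $m$ is identified with $\{0,\dots,m-1\}$. $[H]^n$ is the set of $n$-element subsets of $H$. Two sets of ordinals $a,b$ are aligned if $\mathrm{otp}(a)=\mathrm{otp}(b)$ and $\mathrm{otp}(a\cap\gamma)=\mathrm{otp}(b\cap\gamma)$ for all $\gamma\in a\cap b$; in that case $\mathbf{r}(a,b)=\{i<\mathrm{otp}(a)\mid a(i)=b(i)\}$. A family $\langle u_b\mid b\in[H]^n\rangle$ of sets of ordinals is a uniform $n$-dimensional $\Delta$-system if there are an ordinal $\rho$ and sets $\mathbf{r}_{\mathbf{m}}\subseteq\rho$ for $\mathbf{m}\subseteq n$ such that: (i) $\mathrm{otp}(u_b)=\rho$ for all $b$; (ii) for all $a,b\in[H]^n$ and $\mathbf{m}\subseteq n$, if $a,b$ are aligned with $\mathbf{r}(a,b)=\mathbf{m}$, then $u_a,u_b$ are aligned with $\mathbf{r}(u_a,u_b)=\mathbf{r}_{\mathbf{m}}$; (iii) $\mathbf{r}_{\mathbf{m}_0\cap\mathbf{m}_1}=\mathbf{r}_{\mathbf{m}_0}\cap\mathbf{r}_{\mathbf{m}_1}$ for all $\mathbf{m}_0,\mathbf{m}_1\subseteq n$. A collection of sets is a $\Delta$-system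 with root $r$ if any two distinct members intersect exactly in $r$. -}

module Defs where

open import Data.Nat using (ℕ; zero; suc; _≤_; _<ᵇ_)
open import Data.Nat.Properties using (_≟_)
open import Data.Fin using (Fin; zero; suc; toℕ; inject≤)
import Data.Fin as F
open import Data.Fin.Subset using (Subset; _∈_)
open import Data.Vec using (tabulate)
open import Data.Product using (Σ; ∃; _×_)
open import Data.Bool using (T)
open import Relation.Binary.PropositionalEquality using (_≡_)
open import Relation.Nullary using (yes; no)

-- A finite set of ordinals of size m, given by its increasing enumeration
-- a : Fin m → O (a i = a(i)), lying inside H.
IncIn : {O : Set} → (O → O → Set) → (O → Set) → {m : ℕ} → (Fin m → O) → Set
IncIn _<_ H {m} a = ((i j : Fin m) → i F.< j → a i < a j) × ((i : Fin m) → H (a i))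

StrictIncr : {R O : Set} → (R → R → Set) → (O → O → Set) → (R → O) → Set
StrictIncr {R} _<ρ_ _<_ e = (x y : R) → x <ρ y → e x < e y

-- Alignment of two enumerations with the same index set I:
-- otp(a ∩ γ) = otp(b ∩ γ) for γ ∈ a ∩ b, i.e. common elements sit at the same index.
Aligned : {I O : Set} → (I → O) → (I → O) → Set
Aligned {I} a b = (i j : I) → a i ≡ b j → i ≡ j

RIs : {I O : Set} → (I → O) → (I → O) → (I → Set) → Set
RIs {I} a b m = (i : I) → (a i ≡ b i → m i) × (m i → a i ≡ b i)

prefix : (n m : ℕ) → Subset n
prefix n m = tabulate (λ i → toℕ i <ᵇ m)

Extends : {O : Set} {m n : ℕ} → m ≤ n → (Fin n → O) → (Fin m → O) → Set
Extends {O} {m} m≤n b a = (i : Fin m) → b (inject≤ i m≤n) ≡ a i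

Img : {R O : Set} → (R → O) → (R → Set) → O → Set
Img {R} e S x = Σ R (λ i → S i × e i ≡ x)

-- a ∪ {β} for β above max a, as an enumeration of length suc k
snoc : {O : Set} {k : ℕ} → (Fin k → O) → O → Fin (suc k) → O
snoc {k = zero}  a β zero    = β
snoc {k = suc k} a β zero    = a zero
snoc {k = suc k} a β (suc i) = snoc (λ j → a (suc j)) β i

-- u_a, where b is the chosen end-extension of a (a of length m ≤ n):
-- u_a = u_b if m = n, and u_a = u_b[r_m] if m < n.
USet : {R O : Set} {n : ℕ} → ((Fin n → O) → R → O) → (Subset n → R → Set)
       → (m : ℕ) → (Fin n → O) → O → Set
USet {R} {O} {n} u r m b x with m ≟ n
... | yes _ = Σ R (λ i → u b i ≡ x)
... | no _  = Img (u b) (r (prefix n m)) x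

SameSet : {O : Set} → (O → Set) → (O → Set) → Set
SameSet {O} A B = (x : O) → (A x → B x) × (B x → A x)

-- If b and b′ are increasing in H and agree below m, pick c agreeing with them below m and continuing
-- above both. Then (b, c) and (b′, c) are aligned with root m, so by uniformity u_c agrees with u_b,
-- and with u_b′, exactly on the positions r_m: u_b[r_m] = u_c[r_m] = u_b′[r_m], which is (1).
-- For (2), continue the end-extensions of a ∪ {β} and a ∪ {β′} (β ≠ β′) along disjoint stretches of
-- one chain above both. The resulting c₁, c₂ are aligned with root k, so u_c₁[r_{k+1}] ∩ u_c₂[r_{k+1}]
-- = u_c₁[r_k], using r_k ⊆ r_{k+1}, a consequence of (iii); and u_c₁[r_k] = u_a by (1).
module Submission where

open import Defs
open import Level using (0ℓ) renaming (suc to lsuc)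
open import Data.Nat using (ℕ; zero; suc; _+_; _≤_; _<_)
open import Data.Nat.Properties
  using (<⇒≤; _<?_; <-trans; <⇒<ᵇ; <ᵇ⇒<; ≤∧≮⇒≡; m<1+n⇒m≤n; m≤n⇒m≤1+n; m≤m+n; <⇒≱;
         +-monoʳ-<)
import Data.Nat.Properties as ℕ
open import Data.Fin using (Fin; zero; suc; toℕ; fromℕ; fromℕ<; inject₁; inject≤)
import Data.Fin as F
open import Data.Fin.Properties
  using (toℕ-injective; toℕ-inject≤; toℕ-inject₁; toℕ-fromℕ; toℕ-fromℕ<; toℕ<n)
import Data.Fin.Properties as Fin
open import Data.Fin.Subset using (Subset; _∈_; _∩_; _⊆_)
open import Data.Fin.Subset.Properties using (⊆-antisym; p∩q⊆p; x∈p∩q⁺)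
open import Data.Vec.Properties using (lookup⇒[]=; []=⇒lookup; lookup∘tabulate)
open import Data.Bool.Properties using (T-≡)
open import Data.Product using (Σ; _×_; _,_; proj₁; proj₂; uncurry)
open import Data.Empty using (⊥-elim)
open import Data.Sum using (inj₁; inj₂)
open import Function using (_∘_; id; Equivalence)
open import Function.Definitions using (Injective)
open import Relation.Binary.Bundles using (Setoid)
open import Relation.Binary.Definitions using (Trichotomous; tri<; tri≈; tri>)
open import Relation.Binary.Structures using (IsStrictTotalOrder)
open import Relation.Binary.PropositionalEquality using (_≡_; _≢_; refl; sym; trans; cong; subst)
open import Relation.Nullary using (¬_; yes; no)
import Relation.Unary as U
open import Induction.WellFounded using (WellFounded)
import Relation.Binary.Reasoning.Setoid as SetoidReasoning

SameSet-setoid : Set → Setoid (lsuc 0ℓ) 0ℓ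
SameSet-setoid O = record
  { Carrier = O → Set
  ; _≈_ = SameSet
  ; isEquivalence = record
    { refl = λ _ → id , id
    ; sym = λ A≈B x → proj₂ (A≈B x) , proj₁ (A≈B x)
    ; trans = λ A≈B B≈C x → proj₁ (B≈C x) ∘ proj₁ (A≈B x) , proj₂ (A≈B x) ∘ proj₂ (B≈C x)
    }
  }

SameSet-∩ : {O : Set} {A A′ B B′ : O → Set} →
            SameSet A A′ → SameSet B B′ → SameSet (A U.∩ B) (A′ U.∩ B′)
SameSet-∩ A≈A′ B≈B′ x =
  (λ (a , b) → proj₁ (A≈A′ x) a , proj₁ (B≈B′ x) b) ,
  (λ (a , b) → proj₂ (A≈A′ x) a , proj₂ (B≈B′ x) b)

∈-prefix⁺ : ∀ {n m} {i : Fin n} → toℕ i < m → i ∈ prefix n m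
∈-prefix⁺ {n} {m} {i} i<m =
  lookup⇒[]= i (prefix n m) (trans (lookup∘tabulate _ i) (Equivalence.to T-≡ (<⇒<ᵇ i<m)))

∈-prefix⁻ : ∀ {n m} {i : Fin n} → i ∈ prefix n m → toℕ i < m
∈-prefix⁻ {n} {m} {i} i∈ =
  <ᵇ⇒< (toℕ i) m (Equivalence.from T-≡ (trans (sym (lookup∘tabulate _ i)) ([]=⇒lookup i∈)))

prefix-⊆-suc : ∀ {n k} → prefix n k ⊆ prefix n (suc k)
prefix-⊆-suc = ∈-prefix⁺ ∘ m≤n⇒m≤1+n ∘ ∈-prefix⁻

⊆⇒∩≡ : ∀ {n} {p q : Subset n} → p ⊆ q → p ∩ q ≡ p
⊆⇒∩≡ {p = p} {q} p⊆q = ⊆-antisym (p∩q⊆p p q) (λ i∈p → x∈p∩q⁺ (i∈p , p⊆q i∈p))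

AgreeBelow : {O : Set} {n : ℕ} → ℕ → (Fin n → O) → (Fin n → O) → Set
AgreeBelow m b b′ = ∀ j → toℕ j < m → b j ≡ b′ j

Extends-agree : {O : Set} {m n : ℕ} (m≤n : m ≤ n) (b b′ : Fin n → O) {a : Fin m → O} →
                Extends m≤n b a → Extends m≤n b′ a → AgreeBelow m b b′
Extends-agree m≤n b b′ b⊒a b′⊒a j j<m =
  trans (cong b j≡i) (trans (b⊒a i) (trans (sym (b′⊒a i)) (cong b′ (sym j≡i))))
  where
  i = fromℕ< j<m
  j≡i : j ≡ inject≤ i m≤n
  j≡i = toℕ-injective (sym (trans (toℕ-inject≤ i m≤n) (toℕ-fromℕ< j<m)))

snoc-inject₁ : {O : Set} {k : ℕ} (a : Fin k → O) (β : O) (i : Fin k) → snoc a β (inject₁ i) ≡ a i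
snoc-inject₁ {k = suc k} a β zero    = refl
snoc-inject₁ {k = suc k} a β (suc i) = snoc-inject₁ (a ∘ suc) β i

snoc-fromℕ : {O : Set} (k : ℕ) (a : Fin k → O) (β : O) → snoc a β (fromℕ k) ≡ β
snoc-fromℕ zero    a β = refl
snoc-fromℕ (suc k) a β = snoc-fromℕ k (a ∘ suc) β

Extends-snoc⇒Extends : {O : Set} {k n : ℕ} (k<n : k < n) (b : Fin n → O) {a : Fin k → O} {β : O} →
                       Extends k<n b (snoc a β) → Extends (<⇒≤ k<n) b a
Extends-snoc⇒Extends {k = k} k<n b {a} {β} b⊒aβ i =
  trans (cong b (toℕ-injective (trans (toℕ-inject≤ i (<⇒≤ k<n))
                                      (sym (trans (toℕ-inject≤ (inject₁ i) k<n) (toℕ-inject₁ i))))))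
        (trans (b⊒aβ (inject₁ i)) (snoc-inject₁ a β i))

Extends-snoc-last : {O : Set} {k n : ℕ} (k<n : k < n) (b : Fin n → O) {a : Fin k → O} {β : O} →
                    Extends k<n b (snoc a β) → (j : Fin n) → toℕ j ≡ k → b j ≡ β
Extends-snoc-last {k = k} k<n b {a} {β} b⊒aβ j j≡k =
  trans (cong b (toℕ-injective (trans j≡k (sym (trans (toℕ-inject≤ (fromℕ k) k<n) (toℕ-fromℕ k))))))
        (trans (b⊒aβ (fromℕ k)) (snoc-fromℕ k a β))

Img-RIs : {R O : Set} {x y : R → O} {S : R → Set} → RIs x y S → SameSet (Img x S) (Img y S)
Img-RIs x≡y z =
  (λ (i , i∈S , xi≡z) → i , i∈S , trans (sym (proj₂ (x≡y i) i∈S)) xi≡z) ,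
  (λ (i , i∈S , yi≡z) → i , i∈S , trans (proj₂ (x≡y i) i∈S) yi≡z)

Img-∩-aligned : {R O : Set} {x y : R → O} {Q S : R → Set} →
                Aligned x y → RIs x y Q → (∀ i → Q i → S i) →
                SameSet (Img x S U.∩ Img y S) (Img x Q)
Img-∩-aligned {x = x} {y} {Q} {S} al x≡y Q⊆S z = to , from
  where
  to : (Img x S U.∩ Img y S) z → Img x Q z
  to ((i , _ , xi≡z) , (j , _ , yj≡z)) with al i j (trans xi≡z (sym yj≡z))
  ... | refl = i , proj₁ (x≡y i) (trans xi≡z (sym yj≡z)) , xi≡z
  from : Img x Q z → (Img x S U.∩ Img y S) z
  from (i , i∈Q , xi≡z) =
    (i , Q⊆S i i∈Q , xi≡z) , (i , Q⊆S i i∈Q , trans (sym (proj₂ (x≡y i) i∈Q)) xi≡z)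

aligned-prefix : {O : Set} {n m : ℕ} {x y : Fin n → O} → Injective _≡_ _≡_ x → Injective _≡_ _≡_ y →
                 AgreeBelow m x y →
                 ((i j : Fin n) → ¬ toℕ i < m → ¬ toℕ j < m → x i ≢ y j) →
                 Aligned x y × RIs x y (_∈ prefix n m)
aligned-prefix {n = n} {m} {x} {y} x-inj y-inj agree disjoint = aligned , r≡prefix
  where
  aligned : Aligned x y
  aligned i j xi≡yj with toℕ j <? m | toℕ i <? m
  ... | yes j<m | _       = x-inj (trans xi≡yj (sym (agree j j<m)))
  ... | no _    | yes i<m = y-inj (trans (sym (agree i i<m)) xi≡yj)
  ... | no j≮m  | no i≮m  = ⊥-elim (disjoint i j i≮m j≮m xi≡yj)
  r≡prefix : RIs x y (_∈ prefix n m)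
  r≡prefix i = equal⇒∈ , agree i ∘ ∈-prefix⁻
    where
    equal⇒∈ : x i ≡ y i → i ∈ prefix n m
    equal⇒∈ xi≡yi with toℕ i <? m
    ... | yes i<m = ∈-prefix⁺ i<m
    ... | no i≮m  = ⊥-elim (disjoint i i i≮m i≮m xi≡yi)

r-mono : ∀ {n} {ρ : Set} {r : Subset n → ρ → Set} → (∀ p q x → r (p ∩ q) x → r q x) →
         ∀ {p q} → p ⊆ q → ∀ {x} → r p x → r q x
r-mono {r = r} r-∩⊆ {p} {q} p⊆q {x} rpx = r-∩⊆ p q x (subst (λ s → r s x) (sym (⊆⇒∩≡ p⊆q)) rpx)

glue : {O : Set} {n : ℕ} → ℕ → (Fin n → O) → (Fin n → O) → Fin n → O
glue m b s j with toℕ j <? m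
... | yes _ = b j
... | no  _ = s j

glue-below : {O : Set} {n m : ℕ} {b s : Fin n → O} {j : Fin n} → toℕ j < m → glue m b s j ≡ b j
glue-below {m = m} {j = j} j<m with toℕ j <? m
... | yes _   = refl
... | no j≮m  = ⊥-elim (j≮m j<m)

glue-above : {O : Set} {n m : ℕ} {b s : Fin n → O} {j : Fin n} → ¬ toℕ j < m → glue m b s j ≡ s j
glue-above {m = m} {j = j} j≮m with toℕ j <? m
... | yes j<m = ⊥-elim (j≮m j<m)
... | no _    = refl

module _ {O : Set} {_≺_ : O → O → Set} (≺-sto : IsStrictTotalOrder _≡_ _≺_) where
  open IsStrictTotalOrder ≺-sto using (compare; irrefl) renaming (trans to ≺-trans)

  ≺⇒≢ : ∀ {x y} → x ≺ y → x ≢ y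
  ≺⇒≢ x≺y x≡y = irrefl x≡y x≺y

  strictMono⇒injective : {I : Set} {_<ᵢ_ : I → I → Set} → Trichotomous _≡_ _<ᵢ_ →
                         {f : I → O} → (∀ i j → i <ᵢ j → f i ≺ f j) → Injective _≡_ _≡_ f
  strictMono⇒injective cmp mono {i} {j} fi≡fj with cmp i j
  ... | tri< i<j _ _ = ⊥-elim (≺⇒≢ (mono i j i<j) fi≡fj)
  ... | tri≈ _ i≡j _ = i≡j
  ... | tri> _ _ j<i = ⊥-elim (≺⇒≢ (mono j i j<i) (sym fi≡fj))

  module _ {H : O → Set} where

    IncIn⇒injective : ∀ {k} {b : Fin k → O} → IncIn _≺_ H b → Injective _≡_ _≡_ b
    IncIn⇒injective (b-inc , _) = strictMono⇒injective Fin.<-cmp b-inc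

    glue-IncIn : ∀ {n} m {b s : Fin n → O} →
                 IncIn _≺_ H b → IncIn _≺_ H s → (∀ i j → b i ≺ s j) → IncIn _≺_ H (glue m b s)
    glue-IncIn {n} m {b} {s} (b-inc , b∈H) (s-inc , s∈H) b≺s = increasing , ∈H
      where
      increasing : (i j : Fin n) → i F.< j → glue m b s i ≺ glue m b s j
      increasing i j i<j with toℕ i <? m | toℕ j <? m
      ... | yes _   | yes _   = b-inc i j i<j
      ... | yes _   | no _    = b≺s i j
      ... | no i≮m  | yes j<m = ⊥-elim (i≮m (<-trans i<j j<m))
      ... | no _    | no _    = s-inc i j i<j
      ∈H : (i : Fin n) → H (glue m b s i)
      ∈H i with toℕ i <? m
      ... | yes _ = b∈H i
      ... | no _  = s∈H i

    module _ (unbounded : (x : O) → H x → Σ O (λ y → H y × x ≺ y)) where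

      above₂ : ∀ {x y} → H x → H y → Σ O λ w → H w × x ≺ w × y ≺ w
      above₂ {x} {y} x∈H y∈H with compare x y | unbounded x x∈H | unbounded y y∈H
      ... | tri< x≺y _ _  | _                | w , w∈H , y≺w = w , w∈H , ≺-trans x≺y y≺w , y≺w
      ... | tri≈ _ refl _ | _                | w , w∈H , y≺w = w , w∈H , y≺w , y≺w
      ... | tri> _ _ y≺x  | w , w∈H , x≺w | _                = w , w∈H , x≺w , ≺-trans y≺x x≺w

      bound : ∀ {k} (f : Fin k → O) → (∀ i → H (f i)) → ∀ {x} → H x →
              Σ O λ w → H w × x ≺ w × (∀ i → f i ≺ w)
      bound {zero} f f∈H {x} x∈H = let (w , w∈H , x≺w) = unbounded x x∈H in w , w∈H , x≺w , λ ()
      bound {suc k} f f∈H x∈H =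
        let (w , w∈H , x≺w , f≺w) = bound (f ∘ suc) (f∈H ∘ suc) x∈H
            (v , v∈H , f₀≺v , w≺v) = above₂ (f∈H zero) w∈H
        in v , v∈H , ≺-trans x≺w w≺v , λ { zero → f₀≺v ; (suc i) → ≺-trans (f≺w i) w≺v }

      bound₂ : ∀ {k} (f g : Fin k → O) → (∀ i → H (f i)) → (∀ i → H (g i)) → ∀ {x} → H x →
               Σ O λ w → H w × (∀ i → f i ≺ w) × (∀ i → g i ≺ w)
      bound₂ f g f∈H g∈H x∈H =
        let (w₀ , w₀∈H , _ , g≺w₀) = bound g g∈H x∈H
            (w , w∈H , w₀≺w , f≺w) = bound f f∈H w₀∈H
        in w , w∈H , f≺w , λ i → ≺-trans (g≺w₀ i) w₀≺w

      next : Σ O H → Σ O H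
      next (x , x∈H) = let (y , y∈H , _) = unbounded x x∈H in y , y∈H

      next-≻ : (p : Σ O H) → proj₁ p ≺ proj₁ (next p)
      next-≻ (x , x∈H) = proj₂ (proj₂ (unbounded x x∈H))

      chain : Σ O H → ℕ → Σ O H
      chain p zero    = next p
      chain p (suc j) = next (chain p j)

      chain-above : ∀ p j → proj₁ p ≺ proj₁ (chain p j)
      chain-above p zero    = next-≻ p
      chain-above p (suc j) = ≺-trans (chain-above p j) (next-≻ (chain p j))

      chain-increasing : ∀ p i j → i < j → proj₁ (chain p i) ≺ proj₁ (chain p j)
      chain-increasing p i (suc j) i<1+j with ℕ.m<1+n⇒m<n∨m≡n i<1+j
      ... | inj₁ i<j  = ≺-trans (chain-increasing p i j i<j) (next-≻ (chain p j))
      ... | inj₂ refl = next-≻ (chain p i)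

      chain-injective : ∀ p → Injective _≡_ _≡_ (proj₁ ∘ chain p)
      chain-injective p = strictMono⇒injective ℕ.<-cmp (chain-increasing p)

      chain-IncIn : ∀ p (offset : ℕ) {k} →
                    IncIn _≺_ H (λ (j : Fin k) → proj₁ (chain p (offset + toℕ j)))
      chain-IncIn p offset =
        (λ i j i<j → chain-increasing p _ _ (+-monoʳ-< offset i<j)) ,
        (λ j → proj₂ (chain p (offset + toℕ j)))

      module _ {n : ℕ} (1≤n : 1 ≤ n) {ρ : Set} {u : (Fin n → O) → ρ → O} {r : Subset n → ρ → Set}
        (Δ : (m : Subset n) (a b : Fin n → O) → IncIn _≺_ H a → IncIn _≺_ H b →
             Aligned a b → RIs a b (λ i → i ∈ m) → Aligned (u a) (u b) × RIs (u a) (u b) (r m))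
        (r-monotone : ∀ {p q} → p ⊆ q → ∀ {x} → r p x → r q x) where
        open SetoidReasoning (SameSet-setoid O)

        r-full : ∀ {b} → IncIn _≺_ H b → ∀ i → r (prefix n n) i
        r-full b-inc i = proj₁ (proj₂ (Δ (prefix n n) _ _ b-inc b-inc b-aligned all-in-prefix) i) refl
          where
          b-aligned : Aligned _ _
          b-aligned = λ i j → IncIn⇒injective b-inc
          all-in-prefix : RIs _ _ (_∈ prefix n n)
          all-in-prefix = λ j → (λ _ → ∈-prefix⁺ (toℕ<n j)) , (λ _ → refl)

        USet≈Img : ∀ m {b} → IncIn _≺_ H b → SameSet (USet u r m b) (Img (u b) (r (prefix n m)))
        USet≈Img m b-inc x with m ℕ.≟ n
        ... | yes refl = (λ (i , ubi≡x) → i , r-full b-inc i , ubi≡x) , (λ (i , _ , ubi≡x) → i , ubi≡x)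
        ... | no _     = id , id

        Img-prefix-agree : ∀ {m b b′} → IncIn _≺_ H b → IncIn _≺_ H b′ → AgreeBelow m b b′ →
                           SameSet (Img (u b) (r (prefix n m))) (Img (u b′) (r (prefix n m)))
        Img-prefix-agree {m} {b} {b′} b-inc b′-inc b≡b′
          with bound₂ b b′ (proj₂ b-inc) (proj₂ b′-inc) (proj₂ b-inc (fromℕ< 1≤n))
        ... | w , w∈H , b≺w , b′≺w = begin
          Img (u b)  R ≈⟨ Img-RIs (proj₂ (Δ-with-c b-inc (λ j j<m → sym (glue-below j<m)) b≺w)) ⟩
          Img (u c)  R ≈⟨ Img-RIs (proj₂ (Δ-with-c b′-inc b′≡c b′≺w)) ⟨
          Img (u b′) R ∎
          where
          R = r (prefix n m)
          p = w , w∈H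
          c = glue m b (λ j → proj₁ (chain p (toℕ j)))
          c-inc : IncIn _≺_ H c
          c-inc = glue-IncIn m b-inc (chain-IncIn p 0) (λ i j → ≺-trans (b≺w i) (chain-above p (toℕ j)))
          b′≡c : AgreeBelow m b′ c
          b′≡c j j<m = trans (sym (b≡b′ j j<m)) (sym (glue-below j<m))
          Δ-with-c : ∀ {x} → IncIn _≺_ H x → AgreeBelow m x c → (∀ i → x i ≺ w) →
                     Aligned (u x) (u c) × RIs (u x) (u c) R
          Δ-with-c x-inc x≡c x≺w = uncurry (Δ (prefix n m) _ c x-inc c-inc)
            (aligned-prefix (IncIn⇒injective x-inc) (IncIn⇒injective c-inc) x≡c
              (λ i j _ j≮m xi≡cj →
                 ≺⇒≢ (≺-trans (x≺w i) (chain-above p (toℕ j))) (trans xi≡cj (glue-above j≮m))))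

        USet-agree : ∀ m {b b′} → IncIn _≺_ H b → IncIn _≺_ H b′ → AgreeBelow m b b′ →
                     SameSet (USet u r m b) (USet u r m b′)
        USet-agree m {b} {b′} b-inc b′-inc b≡b′ = begin
          USet u r m b                ≈⟨ USet≈Img m b-inc ⟩
          Img (u b) (r (prefix n m))  ≈⟨ Img-prefix-agree b-inc b′-inc b≡b′ ⟩
          Img (u b′) (r (prefix n m)) ≈⟨ USet≈Img m b′-inc ⟨
          USet u r m b′               ∎

        USet-suc-∩ : ∀ {k b₁ b₂} → IncIn _≺_ H b₁ → IncIn _≺_ H b₂ →
                     AgreeBelow k b₁ b₂ → (∀ j → toℕ j ≡ k → b₁ j ≢ b₂ j) →
                     SameSet (USet u r (suc k) b₁ U.∩ USet u r (suc k) b₂) (USet u r k b₁)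
        USet-suc-∩ {k} {b₁} {b₂} b₁-inc b₂-inc b₁≡b₂ b₁≢b₂
          with bound₂ b₁ b₂ (proj₂ b₁-inc) (proj₂ b₂-inc) (proj₂ b₁-inc (fromℕ< 1≤n))
        ... | w , w∈H , b₁≺w , b₂≺w = begin
          USet u r (suc k) b₁ U.∩ USet u r (suc k) b₂
            ≈⟨ SameSet-∩ (USet-agree (suc k) b₁-inc c₁-inc (λ _ → sym ∘ glue-below))
                         (USet-agree (suc k) b₂-inc c₂-inc (λ _ → sym ∘ glue-below)) ⟩
          USet u r (suc k) c₁ U.∩ USet u r (suc k) c₂
            ≈⟨ SameSet-∩ (USet≈Img (suc k) c₁-inc) (USet≈Img (suc k) c₂-inc) ⟩
          Img (u c₁) (r (prefix n (suc k))) U.∩ Img (u c₂) (r (prefix n (suc k)))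
            ≈⟨ uncurry Img-∩-aligned Δ-c₁-c₂ (λ _ → r-monotone prefix-⊆-suc) ⟩
          Img (u c₁) (r (prefix n k))
            ≈⟨ USet≈Img k c₁-inc ⟨
          USet u r k c₁
            ≈⟨ USet-agree k c₁-inc b₁-inc (λ _ → glue-below ∘ m≤n⇒m≤1+n) ⟩
          USet u r k b₁ ∎
          where
          p = w , w∈H
          c₁ c₂ : Fin n → O
          c₁ = glue (suc k) b₁ (λ j → proj₁ (chain p (toℕ j)))
          c₂ = glue (suc k) b₂ (λ j → proj₁ (chain p (n + toℕ j)))
          c₁-inc : IncIn _≺_ H c₁
          c₁-inc = glue-IncIn (suc k) b₁-inc (chain-IncIn p 0)
                     (λ i j → ≺-trans (b₁≺w i) (chain-above p (toℕ j)))
          c₂-inc : IncIn _≺_ H c₂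
          c₂-inc = glue-IncIn (suc k) b₂-inc (chain-IncIn p n)
                     (λ i j → ≺-trans (b₂≺w i) (chain-above p (n + toℕ j)))
          c₁≡c₂ : AgreeBelow k c₁ c₂
          c₁≡c₂ j j<k =
            trans (glue-below (m≤n⇒m≤1+n j<k)) (trans (b₁≡b₂ j j<k) (sym (glue-below (m≤n⇒m≤1+n j<k))))
          c₁≢c₂ : ∀ i j → ¬ toℕ i < k → ¬ toℕ j < k → c₁ i ≢ c₂ j
          c₁≢c₂ i j i≮k j≮k c₁i≡c₂j with toℕ i <? suc k | toℕ j <? suc k
          ... | yes i≤k | yes j≤k =
            b₁≢b₂ i i≡k (trans c₁i≡c₂j (cong b₂ (toℕ-injective (trans j≡k (sym i≡k)))))
            where
            i≡k = ≤∧≮⇒≡ (m<1+n⇒m≤n i≤k) i≮k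
            j≡k = ≤∧≮⇒≡ (m<1+n⇒m≤n j≤k) j≮k
          ... | yes _   | no _    = ≺⇒≢ (≺-trans (b₁≺w i) (chain-above p (n + toℕ j))) c₁i≡c₂j
          ... | no _    | yes _   = ≺⇒≢ (≺-trans (b₂≺w j) (chain-above p (toℕ i))) (sym c₁i≡c₂j)
          ... | no _    | no _    =
            <⇒≱ (toℕ<n i) (subst (n ≤_) (sym (chain-injective p c₁i≡c₂j)) (m≤m+n n (toℕ j)))
          Δ-c₁-c₂ : Aligned (u c₁) (u c₂) × RIs (u c₁) (u c₂) (r (prefix n k))
          Δ-c₁-c₂ = uncurry (Δ (prefix n k) c₁ c₂ c₁-inc c₂-inc)
                      (aligned-prefix (IncIn⇒injective c₁-inc) (IncIn⇒injective c₂-inc) c₁≡c₂ c₁≢c₂)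

        USet-snoc-∩ : ∀ {k} (k<n : k < n) {a : Fin k → O} {β β′ : O} {b b₁ b₂ : Fin n → O} →
                      IncIn _≺_ H b → IncIn _≺_ H b₁ → IncIn _≺_ H b₂ → Extends (<⇒≤ k<n) b a →
                      Extends k<n b₁ (snoc a β) → Extends k<n b₂ (snoc a β′) →
                      ¬ SameSet (USet u r (suc k) b₁) (USet u r (suc k) b₂) →
                      SameSet (USet u r (suc k) b₁ U.∩ USet u r (suc k) b₂) (USet u r k b)
        USet-snoc-∩ {k} k<n {a} {β} {β′} {b} {b₁} {b₂}
                    b-inc b₁-inc b₂-inc b⊒a b₁⊒aβ b₂⊒aβ′ distinct = begin
          USet u r (suc k) b₁ U.∩ USet u r (suc k) b₂ ≈⟨ USet-suc-∩ b₁-inc b₂-inc b₁≡b₂ b₁≢b₂ ⟩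
          USet u r k b₁                               ≈⟨ USet-agree k b₁-inc b-inc b₁≡b ⟩
          USet u r k b                                ∎
          where
          b₁⊒a : Extends (<⇒≤ k<n) b₁ a
          b₁⊒a = Extends-snoc⇒Extends k<n b₁ b₁⊒aβ
          b₁≡b : AgreeBelow k b₁ b
          b₁≡b = Extends-agree (<⇒≤ k<n) b₁ b b₁⊒a b⊒a
          b₁≡b₂ : AgreeBelow k b₁ b₂
          b₁≡b₂ = Extends-agree (<⇒≤ k<n) b₁ b₂ b₁⊒a (Extends-snoc⇒Extends k<n b₂ b₂⊒aβ′)
          β≢β′ : β ≢ β′
          β≢β′ refl =
            distinct (USet-agree (suc k) b₁-inc b₂-inc (Extends-agree k<n b₁ b₂ b₁⊒aβ b₂⊒aβ′))
          b₁≢b₂ : ∀ j → toℕ j ≡ k → b₁ j ≢ b₂ j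
          b₁≢b₂ j j≡k b₁j≡b₂j =
            β≢β′ (trans (sym (Extends-snoc-last k<n b₁ b₁⊒aβ j j≡k))
                        (trans b₁j≡b₂j (Extends-snoc-last k<n b₂ b₂⊒aβ′ j j≡k)))

lemma2p3 :
    (O : Set) (_≺_ : O → O → Set) → IsStrictTotalOrder _≡_ _≺_ → WellFounded _≺_ →
    (ρ : Set) (_<ρ_ : ρ → ρ → Set) → IsStrictTotalOrder _≡_ _<ρ_ → WellFounded _<ρ_ →
    (H : O → Set) → ((x : O) → H x → Σ O (λ y → H y × x ≺ y)) →
    (n : ℕ) → 1 ≤ n →
    (u : (Fin n → O) → ρ → O) → (r : Subset n → ρ → Set) →
    ((b : Fin n → O) → IncIn _≺_ H b → StrictIncr _<ρ_ _≺_ (u b)) →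
    ((m : Subset n) (a b : Fin n → O) → IncIn _≺_ H a → IncIn _≺_ H b →
      Aligned a b → RIs a b (λ i → i ∈ m) →
      Aligned (u a) (u b) × RIs (u a) (u b) (r m)) →
    ((m₀ m₁ : Subset n) (x : ρ) →
      (r (m₀ ∩ m₁) x → r m₀ x × r m₁ x) × (r m₀ x × r m₁ x → r (m₀ ∩ m₁) x)) →
    ((m : ℕ) (m<n : m < n) (a : Fin m → O) → IncIn _≺_ H a →
      (b b′ : Fin n → O) → IncIn _≺_ H b → IncIn _≺_ H b′ →
      Extends (<⇒≤ m<n) b a → Extends (<⇒≤ m<n) b′ a →
      SameSet (Img (u b) (r (prefix n m))) (Img (u b′) (r (prefix n m))))
    ×
    ((k : ℕ) (k<n : k < n) (a : Fin k → O) → IncIn _≺_ H a →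
      (b : Fin n → O) → IncIn _≺_ H b → Extends (<⇒≤ k<n) b a →
      (β β′ : O) → H β → H β′ → ((i : Fin k) → a i ≺ β) → ((i : Fin k) → a i ≺ β′) →
      (b₁ b₂ : Fin n → O) → IncIn _≺_ H b₁ → IncIn _≺_ H b₂ →
      Extends k<n b₁ (snoc a β) → Extends k<n b₂ (snoc a β′) →
      ¬ SameSet (USet u r (suc k) b₁) (USet u r (suc k) b₂) →
      SameSet (λ x → USet u r (suc k) b₁ x × USet u r (suc k) b₂ x) (USet u r k b))
lemma2p3 _ _ ≺-sto _ _ _ _ _ _ unbounded n 1≤n _ r _ Δ r-∩ =
  (λ m m<n _ _ b b′ b-inc b′-inc b⊒a b′⊒a →
     Img-prefix-agree ≺-sto unbounded 1≤n Δ r-monotone b-inc b′-inc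
                      (Extends-agree (<⇒≤ m<n) b b′ b⊒a b′⊒a)) ,
  (λ k k<n _ _ _ b-inc b⊒a _ _ _ _ _ _ _ _ b₁-inc b₂-inc b₁⊒aβ b₂⊒aβ′ →
     USet-snoc-∩ ≺-sto unbounded 1≤n Δ r-monotone k<n b-inc b₁-inc b₂-inc b⊒a b₁⊒aβ b₂⊒aβ′)
  where
  r-monotone : ∀ {p q : Subset n} → p ⊆ q → ∀ {x} → r p x → r q x
  r-monotone = r-mono (λ p q x → proj₂ ∘ proj₁ (r-∩ p q x))
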